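{- Let $T_n$ be a tree with $n\geq 2$ vertices and let $T(T_n)$ be its total graph. Then $$\kappa_3(T(T_n))=\begin{cases}1, & \text{if } n=2,\\ 2, & \text{if } n\geq 3.\end{cases}$$
   Context: All graphs are finite, simple and undirected. The total graph $T(G)$ of a graph $G$ has vertex set $V(G)\cup E(G)$, where two vertices $x,y$ of $T(G)$ are adjacent iff (i) $x,y\in V(G)$ and $x,y$ are adjacent in $G$, or (ii) $x,y\in E(G)$ and $x,y$ are adjacent (share an endpoint) in $G$, or (iii) $x\in V(G)$, $y\in E(G)$ and $x$ is incident with $y$ in $G$. For a graph $H$ and $S\subseteq V(H)$ with $|S|\geq 2$, an $S$-tree is a subgraph of $H$ that is a tree containing $S$. Two $S$-trees $T,T'$ are internally disjoint if $E(T)\cap E(T')=\emptyset$ and $V(T)\cap V(T')=S$. $\kappa(S)$ is the maximum number of pairwise internally disjoint $S$-trees in $H$, and the generalized $k$-connectivity is $\kappa_k(H)=\min\{\kappa(S): S\subseteq V(H), |S|=k\}$ (for $H$ with at least $k$ vertices). -}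

module Defs where

open import Data.Nat using (ℕ; suc)
open import Data.Fin using (Fin; _<_)
open import Data.Bool using (Bool; true; false)
open import Data.Product using (Σ; _×_; _,_; proj₁; proj₂)
open import Data.Sum using (_⊎_; inj₁; inj₂)
open import Data.Unit using (⊤)
open import Data.Empty using (⊥)
open import Data.List using (List; []; _∷_; _∷ʳ_)
open import Data.List.Relation.Unary.Linked using (Linked)
open import Data.List.Relation.Unary.Unique.Propositional using (Unique)
open import Relation.Nullary using (¬_)
open import Relation.Binary.PropositionalEquality using (_≡_; _≢_)

record SimpleGraph (n : ℕ) : Set where
  field
    adj    : Fin n → Fin n → Bool
    sym    : ∀ i j → adj i j ≡ adj j i
    irrefl : ∀ i → adj i i ≡ false

open SimpleGraph public

-- Edges of G: unordered pairs {i,j}, represented by i < j, with i ~ j.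
Edge : ∀ {n} → SimpleGraph n → Set
Edge {n} G = Σ (Fin n × Fin n) λ p → (proj₁ p < proj₂ p) × (adj G (proj₁ p) (proj₂ p) ≡ true)

endA endB : ∀ {n} {G : SimpleGraph n} → Edge G → Fin n
endA e = proj₁ (proj₁ e)
endB e = proj₂ (proj₁ e)

Incident : ∀ {n} {G : SimpleGraph n} → Fin n → Edge G → Set
Incident {G = G} x e = (x ≡ endA {G = G} e) ⊎ (x ≡ endB {G = G} e)

EdgesAdjacent : ∀ {n} {G : SimpleGraph n} → Edge G → Edge G → Set
EdgesAdjacent {G = G} e f =
  (e ≢ f) × ((Incident {G = G} (endA {G = G} e) f) ⊎ (Incident {G = G} (endB {G = G} e) f))

Graph : Set → Set₁
Graph V = V → V → Set

TotalGraph : ∀ {n} (G : SimpleGraph n) → Graph (Fin n ⊎ Edge G)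
TotalGraph G (inj₁ x) (inj₁ y) = adj G x y ≡ true
TotalGraph G (inj₂ e) (inj₂ f) = EdgesAdjacent {G = G} e f
TotalGraph G (inj₁ x) (inj₂ e) = Incident {G = G} x e
TotalGraph G (inj₂ e) (inj₁ x) = Incident {G = G} x e

data Walk {V : Set} (E : V → V → Set) : V → V → Set where
  here : ∀ {x} → Walk E x x
  step : ∀ {x y z} → E x y → Walk E y z → Walk E x z

Cycle : {V : Set} → (V → V → Set) → Set
Cycle {V} E = Σ V λ v0 → Σ V λ v1 → Σ V λ v2 → Σ (List V) λ rest →
  Unique (v0 ∷ v1 ∷ v2 ∷ rest) × Linked E ((v0 ∷ v1 ∷ v2 ∷ rest) ∷ʳ v0)

IsTreeOn : {V : Set} → (V → Set) → (V → V → Set) → Set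
IsTreeOn {V} inV E =
  (∀ x y → inV x → inV y → Walk E x y) × ¬ Cycle E

IsTree : ∀ {n} → SimpleGraph n → Set
IsTree G = IsTreeOn (λ _ → ⊤) (λ i j → adj G i j ≡ true)

record Subgraph {V : Set} (H : Graph V) : Set₁ where
  field
    inV    : V → Set
    inE    : V → V → Set
    E-sym  : ∀ {x y} → inE x y → inE y x
    E-adj  : ∀ {x y} → inE x y → H x y
    E-ends : ∀ {x y} → inE x y → inV x × inV y

open Subgraph public

IsSTree : {V : Set} {H : Graph V} → (V → Set) → Subgraph H → Set
IsSTree S T = (∀ v → S v → inV T v) × IsTreeOn (inV T) (inE T)

InternallyDisjoint : {V : Set} {H : Graph V} → (V → Set) → Subgraph H → Subgraph H → Set
InternallyDisjoint S T T′ =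
  (∀ x y → inE T x y → inE T′ x y → ⊥) × (∀ v → inV T v → inV T′ v → S v)

-- H contains k pairwise internally disjoint S-trees  (i.e. κ(S) ≥ k)
HasDisjointSTrees : {V : Set} (H : Graph V) → (V → Set) → ℕ → Set₁
HasDisjointSTrees H S k = Σ (Fin k → Subgraph H) λ T →
  (∀ i → IsSTree S (T i)) × (∀ i j → i ≢ j → InternallyDisjoint S (T i) (T j))

Three : {V : Set} → V → V → V → V → Set
Three a b c v = (v ≡ a) ⊎ (v ≡ b) ⊎ (v ≡ c)

Distinct3 : {V : Set} → V → V → V → Set
Distinct3 a b c = (a ≢ b) × (a ≢ c) × (b ≢ c)

-- κ₃(H) = k, i.e. min over 3-sets S of κ(S) equals k:
-- every 3-set S has κ(S) ≥ k, and some 3-set S has κ(S) < k + 1.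
Kappa3Is : {V : Set} → Graph V → ℕ → Set₁
Kappa3Is {V} H k =
  (∀ a b c → Distinct3 a b c → HasDisjointSTrees H (Three a b c) k) ×
  (Σ V λ a → Σ V λ b → Σ V λ c →
     Distinct3 a b c × ¬ HasDisjointSTrees H (Three a b c) (suc k))

module Submission where

-- Lower bound (n ≥ 3; in fact for every connected graph G with at least
-- three vertices).  For a 3-set S of T(G) we build two S-trees from parent
-- pointers (ParentTree: a parent map lowering a height function yields a
-- tree).  The vertex tree is a shortest-walk spanning tree of G with the
-- edge-vertices of S hung on an end; the edge tree is a spanning tree of
-- the line graph with the vertex-vertices of S hung on an incident edge.
-- They meet only in S and share a link only if S = {x, y, xy} with xy the
-- only edge at x and y, which a third vertex rules out (LowerBound).
-- For n = 2 the vertex tree alone gives κ₃ ≥ 1.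
--
-- Upper bound.  Take a pendant edge xx′ (LeafSearch: every acyclic graph
-- with an edge has a leaf) and S = {x, x′, xx′}.  In T(G) the vertex x has
-- exactly the two neighbours x′ and xx′, so κ(S) ≤ 2 (degreeBound); for
-- n = 2, T(G) is a triangle and κ(S) ≤ 1 (triangleBound).

open import Defs hiding (sym)
open import Data.Nat using (ℕ; zero; suc; _+_; _≤_; _<_; _≤?_; z≤n; s≤s)
import Data.Nat.Properties as ℕ
open import Data.Fin using (Fin) renaming (_<_ to _<ᶠ_)
import Data.Fin.Properties as Fin
open import Data.Bool using (Bool; true)
import Data.Bool.Properties as Bool
open import Data.Product using (Σ; _×_; _,_; proj₁; proj₂; ∃₂)
open import Data.Sum using (_⊎_; inj₁; inj₂)
open import Data.Sum.Properties as Sum using (inj₁-injective; inj₂-injective)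
open import Data.Unit using (⊤; tt)
open import Data.Empty using (⊥; ⊥-elim)
open import Data.List using (List; []; _∷_; _∷ʳ_; length; lookup)
open import Data.List.Relation.Unary.Linked using (Linked; []; [-]; _∷_)
open import Data.List.Relation.Unary.All using (All; []; _∷_)
open import Data.List.Relation.Unary.Any using (here; there)
import Data.List.Relation.Unary.Any as Any
open import Data.List.Relation.Unary.AllPairs using ([]; _∷_)
open import Data.List.Relation.Unary.Unique.Propositional using (Unique)
open import Data.List.Membership.Propositional using (_∈_)
open import Relation.Nullary using (¬_; Dec; yes; no)
open import Relation.Nullary.Decidable using (_×-dec_; _⊎-dec_; ¬?)
open import Relation.Binary using (DecidableEquality; tri<; tri≈; tri>)
open import Relation.Binary.PropositionalEquality
  using (_≡_; _≢_; refl; sym; trans; subst; cong)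
import Axiom.UniquenessOfIdentityProofs as UIP

_++ʷ_ : ∀ {V : Set} {E : V → V → Set} {x y z} → Walk E x y → Walk E y z → Walk E x z
here ++ʷ q = q
step e p ++ʷ q = step e (p ++ʷ q)

reverseʷ : ∀ {V : Set} {E : V → V → Set} → (∀ {x y} → E x y → E y x) →
           ∀ {x y} → Walk E x y → Walk E y x
reverseʷ E-sym here = here
reverseʷ E-sym (step e p) = reverseʷ E-sym p ++ʷ step (E-sym e) here

firstStep : ∀ {V : Set} {E : V → V → Set} {u v} → Walk E u v → u ≢ v → Σ V λ w → E u w
firstStep here u≢u = ⊥-elim (u≢u refl)
firstStep (step e _) _ = _ , e

-- A parent map on a vertex set InT of H, defined off a root and strictly
-- lowering a height function, spans a tree: its links x — parent x form a
-- connected (walk to the root) acyclic subgraph.  Both S-trees of the lower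
-- bound are built this way.
module ParentTree {V : Set} (H : Graph V) (H-sym : ∀ {x y} → H x y → H y x)
  (InT : V → Set) (root : V) (root∈T : InT root)
  (NonRoot : V → Set) (root-or-not : ∀ x → InT x → x ≡ root ⊎ NonRoot x)
  (nonRoot∈T : ∀ {x} → NonRoot x → InT x)
  (parent : V → V) (height : V → ℕ)
  (parent∈T : ∀ {x} → NonRoot x → InT (parent x))
  (parent-adj : ∀ {x} → NonRoot x → H x (parent x))
  (parent-lower : ∀ {x} → NonRoot x → height (parent x) < height x) where

  Up Down Link : V → V → Set
  Up x y = NonRoot x × y ≡ parent x
  Down x y = Up y x
  Link x y = Up x y ⊎ Down x y

  Link-sym : ∀ {x y} → Link x y → Link y x
  Link-sym (inj₁ u) = inj₂ u
  Link-sym (inj₂ d) = inj₁ d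

  Link-adj : ∀ {x y} → Link x y → H x y
  Link-adj (inj₁ (nr , refl)) = parent-adj nr
  Link-adj (inj₂ (nr , refl)) = H-sym (parent-adj nr)

  Link-ends : ∀ {x y} → Link x y → InT x × InT y
  Link-ends (inj₁ (nr , refl)) = nonRoot∈T nr , parent∈T nr
  Link-ends (inj₂ (nr , refl)) = parent∈T nr , nonRoot∈T nr

  tree : Subgraph H
  tree = record { inV = InT ; inE = Link ; E-sym = Link-sym ; E-adj = Link-adj ; E-ends = Link-ends }

  -- Following parents from x reaches the root within height x steps.
  walkToRoot : ∀ x → InT x → Walk Link x root
  walkToRoot x x∈T = go (suc (height x)) x ℕ.≤-refl x∈T
    where
    go : (fuel : ℕ) → ∀ x → height x < fuel → InT x → Walk Link x root
    go (suc fuel) x (s≤s h≤fuel) x∈T with root-or-not x x∈T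
    ... | inj₁ refl = here
    ... | inj₂ nr = step (inj₁ (nr , refl))
                         (go fuel (parent x) (ℕ.≤-trans (parent-lower nr) h≤fuel) (parent∈T nr))

  connected : ∀ x y → InT x → InT y → Walk Link x y
  connected x y x∈T y∈T = walkToRoot x x∈T ++ʷ reverseʷ Link-sym (walkToRoot y y∈T)

  -- A cycle never backtracks, and along a non-backtracking
  -- walk a Down step can only be followed by Down steps (Down then Up
  -- returns to the same vertex).  So a cycle is a run of Up steps followed
  -- by a run of Down steps; comparing heights around the closed walk gives
  -- a contradiction.

  lastOf : V → List V → V
  lastOf x [] = x
  lastOf _ (y ∷ ys) = lastOf y ys

  headOr : List V → V → V
  headOr [] t = t
  headOr (z ∷ _) _ = z

  NoBacktrack : List V → Set
  NoBacktrack (x ∷ y ∷ z ∷ rest) = (x ≢ z) × NoBacktrack (y ∷ z ∷ rest)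
  NoBacktrack _ = ⊤

  noBacktrack-tail : ∀ x y ws → NoBacktrack (x ∷ y ∷ ws) → NoBacktrack (y ∷ ws)
  noBacktrack-tail x y [] _ = tt
  noBacktrack-tail x y (w ∷ ws) (_ , nb) = nb

  down-up-backtracks : ∀ {x y z} → Down x y → Up y z → x ≡ z
  down-up-backtracks (_ , p) (_ , q) = trans p (sym q)

  down-raises : ∀ {x y} → Down x y → height x < height y
  down-raises (nr , refl) = parent-lower nr

  descending : ∀ x zs t → Down x (headOr zs t) → Linked Link (x ∷ zs ∷ʳ t) →
               NoBacktrack (x ∷ zs ∷ʳ t) → height x < height t × Down (lastOf x zs) t
  descending x [] t d _ _ = down-raises d , d
  descending x (y ∷ []) t d (_ ∷ inj₁ u ∷ _) (x≢t , _) = ⊥-elim (x≢t (down-up-backtracks d u))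
  descending x (y ∷ z ∷ zs) t d (_ ∷ inj₁ u ∷ _) (x≢z , _) = ⊥-elim (x≢z (down-up-backtracks d u))
  descending x (y ∷ []) t d (_ ∷ inj₂ d′ ∷ _) _ = ℕ.<-trans (down-raises d) (down-raises d′) , d′
  descending x (y ∷ z ∷ zs) t d (_ ∷ l@(inj₂ d′ ∷ _)) (_ , nb)
    with descending y (z ∷ zs) t d′ l nb
  ... | y<t , last = ℕ.<-trans (down-raises d) y<t , last

  up-lowers : ∀ {x y} → Up x y → height y < height x
  up-lowers (nr , refl) = parent-lower nr

  upThenDown : ∀ x zs t → Linked Link (x ∷ zs ∷ʳ t) → NoBacktrack (x ∷ zs ∷ʳ t) →
               height t < height x ⊎ Down (lastOf x zs) t
  upThenDown x [] t (inj₁ u ∷ _) _ = inj₁ (up-lowers u)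
  upThenDown x [] t (inj₂ d ∷ _) _ = inj₂ d
  upThenDown x (y ∷ zs) t l@(inj₂ d ∷ _) nb = inj₂ (proj₂ (descending x (y ∷ zs) t d l nb))
  upThenDown x (y ∷ zs) t (inj₁ u ∷ l) nb
    with upThenDown y zs t l (noBacktrack-tail x y (zs ∷ʳ t) nb)
  ... | inj₁ t<y = inj₁ (ℕ.<-trans t<y (up-lowers u))
  ... | inj₂ last = inj₂ last

  cycle-noBacktrack : ∀ v0 v1 v2 rest → Unique (v0 ∷ v1 ∷ v2 ∷ rest) →
                      NoBacktrack ((v0 ∷ v1 ∷ v2 ∷ rest) ∷ʳ v0)
  cycle-noBacktrack v0 v1 v2 rest ((v0∉ @ (_ ∷ v0≢v2 ∷ _)) ∷ unique-tail) =
    v0≢v2 , open-path (v1 ∷ v2 ∷ rest) v0∉ unique-tail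
    where
    open-path : ∀ xs → All (v0 ≢_) xs → Unique xs → NoBacktrack (xs ∷ʳ v0)
    open-path [] _ _ = tt
    open-path (x ∷ []) _ _ = tt
    open-path (x ∷ y ∷ []) (v0≢x ∷ _) _ = (λ x≡v0 → v0≢x (sym x≡v0)) , tt
    open-path (x ∷ y ∷ z ∷ xs) (_ ∷ v0∉) ((_ ∷ x≢z ∷ _) ∷ u) = x≢z , open-path (y ∷ z ∷ xs) v0∉ u

  all-lastOf : ∀ {P : V → Set} y ys → All P (y ∷ ys) → P (lastOf y ys)
  all-lastOf y [] (p ∷ _) = p
  all-lastOf y (z ∷ zs) (_ ∷ ps) = all-lastOf z zs ps

  acyclic : ¬ Cycle Link
  acyclic (v0 , v1 , v2 , rest , unique@(_ ∷ (v1∉ ∷ _)) , links@(first ∷ _)) =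
    closes (upThenDown v0 (v1 ∷ v2 ∷ rest) v0 links nb) first
    where
    nb : NoBacktrack ((v0 ∷ v1 ∷ v2 ∷ rest) ∷ʳ v0)
    nb = cycle-noBacktrack v0 v1 v2 rest unique
    -- the last step enters v0 from its parent, so the first step cannot
    -- go up to the parent again (it would revisit the last vertex)
    closes : height v0 < height v0 ⊎ Down (lastOf v2 rest) v0 → Link v0 v1 → ⊥
    closes (inj₁ v0<v0) _ = ℕ.<-irrefl refl v0<v0
    closes (inj₂ (_ , last≡parent)) (inj₁ (_ , v1≡parent)) =
      all-lastOf v2 rest v1∉ (trans v1≡parent (sym last≡parent))
    closes (inj₂ _) (inj₂ d) =
      ℕ.<-irrefl refl (proj₁ (descending v0 (v1 ∷ v2 ∷ rest) v0 d links nb))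

  isTree : IsTreeOn InT Link
  isTree = connected , acyclic

-- Three-element sets.  If u, v, w are distinct members of {a, b, c}, then
-- {a, b, c} = {u, v, w}: list u first, then v second, and w is what is left.
module _ {V : Set} where

  Three-swap₁₂ : ∀ {a b c t : V} → Three a b c t → Three b a c t
  Three-swap₁₂ (inj₁ t≡a) = inj₂ (inj₁ t≡a)
  Three-swap₁₂ (inj₂ (inj₁ t≡b)) = inj₁ t≡b
  Three-swap₁₂ (inj₂ (inj₂ t≡c)) = inj₂ (inj₂ t≡c)

  Three-swap₂₃ : ∀ {a b c t : V} → Three a b c t → Three a c b t
  Three-swap₂₃ (inj₁ t≡a) = inj₁ t≡a
  Three-swap₂₃ (inj₂ (inj₁ t≡b)) = inj₂ (inj₂ t≡b)
  Three-swap₂₃ (inj₂ (inj₂ t≡c)) = inj₂ (inj₁ t≡c)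

  Three-first : ∀ {a b c u : V} → Three a b c u →
                Σ V λ p → Σ V λ q → ∀ {t} → Three a b c t → Three u p q t
  Three-first {b = b} {c} (inj₁ refl) = b , c , λ t∈ → t∈
  Three-first {a = a} {c = c} (inj₂ (inj₁ refl)) = a , c , Three-swap₁₂
  Three-first {a = a} {b} (inj₂ (inj₂ refl)) = a , b , λ t∈ → Three-swap₁₂ (Three-swap₂₃ t∈)

  Three-second : ∀ {u p q v : V} → v ≢ u → Three u p q v →
                 Σ V λ r → ∀ {t} → Three u p q t → Three u v r t
  Three-second v≢u (inj₁ v≡u) = ⊥-elim (v≢u v≡u)
  Three-second {q = q} _ (inj₂ (inj₁ refl)) = q , λ t∈ → t∈
  Three-second {p = p} _ (inj₂ (inj₂ refl)) = p , Three-swap₂₃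

  Three-third : ∀ {u v r w : V} → w ≢ u → w ≢ v → Three u v r w → w ≡ r
  Three-third w≢u _ (inj₁ w≡u) = ⊥-elim (w≢u w≡u)
  Three-third _ w≢v (inj₂ (inj₁ w≡v)) = ⊥-elim (w≢v w≡v)
  Three-third _ _ (inj₂ (inj₂ w≡r)) = w≡r

  Three-exhausted : ∀ {a b c u v w t : V} → Distinct3 u v w →
                    Three a b c u → Three a b c v → Three a b c w → Three a b c t → Three u v w t
  Three-exhausted {u = u} {v} {w} {t} (u≢v , u≢w , v≢w) u∈ v∈ w∈ t∈
    with Three-first u∈
  ... | p , q , from-u with Three-second (λ v≡u → u≢v (sym v≡u)) (from-u v∈)
  ...   | r , from-uv =
    subst (λ r → Three u v r t) (sym w≡r) (from-uv (from-u t∈))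
    where
    w≡r : w ≡ r
    w≡r = Three-third (λ w≡u → u≢w (sym w≡u)) (λ w≡v → v≢w (sym w≡v)) (from-uv (from-u w∈))

module GraphFacts {n : ℕ} (G : SimpleGraph n) where

  A : Fin n → Fin n → Set
  A i j = adj G i j ≡ true

  A-sym : ∀ {i j} → A i j → A j i
  A-sym {i} {j} p = trans (SimpleGraph.sym G j i) p

  A-irrefl : ∀ {i j} → A i j → i ≢ j
  A-irrefl {i} p refl with trans (sym p) (irrefl G i)
  ... | ()

  E : Set
  E = Edge G

  end₁ end₂ : E → Fin n
  end₁ = endA {G = G}
  end₂ = endB {G = G}

  Inc : Fin n → E → Set
  Inc = Incident {G = G}

  ends-ordered : (f : E) → end₁ f <ᶠ end₂ f
  ends-ordered f = proj₁ (proj₂ f)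

  ends-adjacent : (f : E) → A (end₁ f) (end₂ f)
  ends-adjacent f = proj₂ (proj₂ f)

  ends-distinct : (f : E) → end₁ f ≢ end₂ f
  ends-distinct f eq = Fin.<-irrefl eq (ends-ordered f)

  A-irrelevant : ∀ {b c : Bool} (p q : b ≡ c) → p ≡ q
  A-irrelevant = UIP.Decidable⇒UIP.≡-irrelevant Bool._≟_

  edge-≡ : (f g : E) → end₁ f ≡ end₁ g → end₂ f ≡ end₂ g → f ≡ g
  edge-≡ ((a , b) , lt , p) ((.a , .b) , lt′ , p′) refl refl
    with ℕ.<-irrelevant lt lt′ | A-irrelevant p p′
  ... | refl | refl = refl

  _≟E_ : DecidableEquality E
  f ≟E g with end₁ f Fin.≟ end₁ g | end₂ f Fin.≟ end₂ g
  ... | yes eq₁ | yes eq₂ = yes (edge-≡ f g eq₁ eq₂)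
  ... | no neq₁ | _ = no λ f≡g → neq₁ (cong end₁ f≡g)
  ... | yes _ | no neq₂ = no λ f≡g → neq₂ (cong end₂ f≡g)

  same-ends : (f g : E) → Inc (end₁ f) g → Inc (end₂ f) g → f ≡ g
  same-ends f g (inj₁ a) (inj₁ b) = ⊥-elim (ends-distinct f (trans a (sym b)))
  same-ends f g (inj₁ a) (inj₂ b) = edge-≡ f g a b
  same-ends f g (inj₂ refl) (inj₁ refl) = ⊥-elim (Fin.<-asym (ends-ordered f) (ends-ordered g))
  same-ends f g (inj₂ a) (inj₂ b) = ⊥-elim (ends-distinct f (trans a (sym b)))

  edge-determined : ∀ {x y} (f g : E) → x ≢ y → Inc x f → Inc y f → Inc x g → Inc y g → f ≡ g
  edge-determined f g x≢y (inj₁ refl) (inj₁ refl) _ _ = ⊥-elim (x≢y refl)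
  edge-determined f g x≢y (inj₂ refl) (inj₂ refl) _ _ = ⊥-elim (x≢y refl)
  edge-determined f g _ (inj₁ refl) (inj₂ refl) gx gy = same-ends f g gx gy
  edge-determined f g _ (inj₂ refl) (inj₁ refl) gx gy = same-ends f g gy gx

  edgeOf : ∀ u v → A u v → E
  edgeOf u v p with Fin.<-cmp u v
  ... | tri< u<v _ _ = (u , v) , u<v , p
  ... | tri≈ _ u≡v _ = ⊥-elim (A-irrefl p u≡v)
  ... | tri> _ _ v<u = (v , u) , v<u , A-sym p

  edgeOf-inc₁ : ∀ u v p → Inc u (edgeOf u v p)
  edgeOf-inc₁ u v p with Fin.<-cmp u v
  ... | tri< _ _ _ = inj₁ refl
  ... | tri≈ _ u≡v _ = ⊥-elim (A-irrefl p u≡v)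
  ... | tri> _ _ _ = inj₂ refl

  edgeOf-inc₂ : ∀ u v p → Inc v (edgeOf u v p)
  edgeOf-inc₂ u v p with Fin.<-cmp u v
  ... | tri< _ _ _ = inj₂ refl
  ... | tri≈ _ u≡v _ = ⊥-elim (A-irrefl p u≡v)
  ... | tri> _ _ _ = inj₁ refl

  otherEnd : ∀ {x} (f : E) → Inc x f → Fin n
  otherEnd f (inj₁ _) = end₂ f
  otherEnd f (inj₂ _) = end₁ f

  otherEnd-adj : ∀ {x} (f : E) (i : Inc x f) → A x (otherEnd f i)
  otherEnd-adj f (inj₁ refl) = ends-adjacent f
  otherEnd-adj f (inj₂ refl) = A-sym (ends-adjacent f)

  otherEnd-inc : ∀ {x} (f : E) (i : Inc x f) → Inc (otherEnd f i) f
  otherEnd-inc f (inj₁ _) = inj₂ refl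
  otherEnd-inc f (inj₂ _) = inj₁ refl

  TV : Set
  TV = Fin n ⊎ E

  H : Graph TV
  H = TotalGraph G

  _≟T_ : DecidableEquality TV
  _≟T_ = Sum.≡-dec Fin._≟_ _≟E_

  H-sym : ∀ {x y} → H x y → H y x
  H-sym {inj₁ x} {inj₁ y} p = A-sym p
  H-sym {inj₁ x} {inj₂ f} i = i
  H-sym {inj₂ f} {inj₁ x} i = i
  H-sym {inj₂ e} {inj₂ f} (e≢f , shared) = (λ f≡e → e≢f (sym f≡e)) , flip shared
    where
    flip : Inc (end₁ e) f ⊎ Inc (end₂ e) f → Inc (end₁ f) e ⊎ Inc (end₂ f) e
    flip (inj₁ (inj₁ q)) = inj₁ (inj₁ (sym q))
    flip (inj₁ (inj₂ q)) = inj₂ (inj₁ (sym q))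
    flip (inj₂ (inj₁ q)) = inj₁ (inj₂ (sym q))
    flip (inj₂ (inj₂ q)) = inj₂ (inj₂ (sym q))

  shared-end-adjacent : ∀ {x} f g → f ≢ g → Inc x f → Inc x g → EdgesAdjacent {G = G} f g
  shared-end-adjacent f g f≢g (inj₁ refl) xg = f≢g , inj₁ xg
  shared-end-adjacent f g f≢g (inj₂ refl) xg = f≢g , inj₂ xg

least : (P : ℕ → Set) → (∀ k → Dec (P k)) → ∀ m → P m →
        Σ ℕ λ k → P k × (∀ j → P j → k ≤ j)
least P P? zero p = zero , p , λ _ _ → z≤n
least P P? (suc m) p with P? zero
... | yes p0 = zero , p0 , λ _ _ → z≤n
... | no ¬p0 with least (λ k → P (suc k)) (λ k → P? (suc k)) m p
...   | k , pk , k-least = suc k , pk , below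
  where
  below : ∀ j → P j → suc k ≤ j
  below zero pj = ⊥-elim (¬p0 pj)
  below (suc j) pj = s≤s (k-least j pj)

-- Rooting a connected simple graph at r: the height of v is its distance to
-- r, and every v ≠ r has a neighbour ("parent") of smaller height.
module Rooting {n : ℕ} (G : SimpleGraph n) (r : Fin n)
  (connected : ∀ x y → Walk (GraphFacts.A G) x y) where
  open GraphFacts G

  -- v is joined to r by a walk with at most k edges
  Near : ℕ → Fin n → Set
  Near zero v = v ≡ r
  Near (suc k) v = v ≡ r ⊎ Σ (Fin n) λ w → A v w × Near k w

  Near? : ∀ k v → Dec (Near k v)
  Near? zero v = v Fin.≟ r
  Near? (suc k) v = (v Fin.≟ r) ⊎-dec Fin.any? (λ w → (adj G v w Bool.≟ true) ×-dec Near? k w)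

  walk-near : ∀ {v} → Walk A v r → Σ ℕ λ k → Near k v
  walk-near here = zero , refl
  walk-near (step e p) with walk-near p
  ... | k , near = suc k , inj₂ (_ , e , near)

  distance : ∀ v → Σ ℕ λ k → Near k v × (∀ j → Near j v → k ≤ j)
  distance v with walk-near (connected v r)
  ... | m , near = least (λ k → Near k v) (λ k → Near? k v) m near

  height : Fin n → ℕ
  height v = proj₁ (distance v)

  -- the first step of a short walk to r (v itself when v = r)
  nextStep : ∀ {v} k → Near k v → Fin n
  nextStep (suc k) (inj₂ (w , _)) = w
  nextStep {v} _ _ = v

  nextStep-spec : ∀ {v} k (near : Near k v) → v ≢ r →
                  A v (nextStep k near) × height (nextStep k near) < k
  nextStep-spec zero v≡r v≢r = ⊥-elim (v≢r v≡r)
  nextStep-spec (suc k) (inj₁ v≡r) v≢r = ⊥-elim (v≢r v≡r)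
  nextStep-spec (suc k) (inj₂ (w , v~w , near)) _ = v~w , s≤s (proj₂ (proj₂ (distance w)) k near)

  parent : Fin n → Fin n
  parent v = nextStep (height v) (proj₁ (proj₂ (distance v)))

  parent-spec : ∀ v → v ≢ r → A v (parent v) × height (parent v) < height v
  parent-spec v = nextStep-spec (height v) (proj₁ (proj₂ (distance v)))

-- The first S-tree of the lower bound: the shortest-walk spanning tree of G
-- on the vertex-vertices, with every edge-vertex e ∈ S hung on one of its
-- ends, attach e.  It meets the edge-vertices only in S.
module VertexTree {n : ℕ} (G : SimpleGraph n) (r : Fin n)
  (connected : ∀ x y → Walk (GraphFacts.A G) x y)
  (S : GraphFacts.TV G → Set)
  (attach : Edge G → Fin n) (attach-inc : ∀ e → Incident {G = G} (attach e) e) where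
  open GraphFacts G
  module R = Rooting G r connected

  InT NonRoot : TV → Set
  InT (inj₁ v) = ⊤
  InT (inj₂ e) = S (inj₂ e)
  NonRoot (inj₁ v) = v ≢ r
  NonRoot (inj₂ e) = S (inj₂ e)

  up : TV → TV
  up (inj₁ v) = inj₁ (R.parent v)
  up (inj₂ e) = inj₁ (attach e)

  level : TV → ℕ
  level (inj₁ v) = R.height v
  level (inj₂ e) = suc (R.height (attach e))

  root-or-not : ∀ x → InT x → x ≡ inj₁ r ⊎ NonRoot x
  root-or-not (inj₁ v) _ with v Fin.≟ r
  ... | yes refl = inj₁ refl
  ... | no v≢r = inj₂ v≢r
  root-or-not (inj₂ e) e∈S = inj₂ e∈S

  nonRoot∈T : ∀ {x} → NonRoot x → InT x
  nonRoot∈T {inj₁ _} _ = tt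
  nonRoot∈T {inj₂ _} e∈S = e∈S

  up∈T : ∀ {x} → NonRoot x → InT (up x)
  up∈T {inj₁ _} _ = tt
  up∈T {inj₂ _} _ = tt

  up-adj : ∀ {x} → NonRoot x → H x (up x)
  up-adj {inj₁ v} v≢r = proj₁ (R.parent-spec v v≢r)
  up-adj {inj₂ e} _ = attach-inc e

  up-lower : ∀ {x} → NonRoot x → level (up x) < level x
  up-lower {inj₁ v} v≢r = proj₂ (R.parent-spec v v≢r)
  up-lower {inj₂ e} _ = ℕ.n<1+n _

  open ParentTree H H-sym InT (inj₁ r) tt NonRoot root-or-not
    (λ {x} → nonRoot∈T {x}) up level (λ {x} → up∈T {x}) (λ {x} → up-adj {x})
    (λ {x} → up-lower {x}) public

  S⊆T : ∀ t → S t → InT t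
  S⊆T (inj₁ _) _ = tt
  S⊆T (inj₂ _) e∈S = e∈S

  isSTree : IsSTree S tree
  isSTree = S⊆T , isTree

-- The second S-tree of the lower bound: a spanning tree of the line graph
-- on all edge-vertices, with every vertex-vertex v ∈ S hung on an edge
-- choose v at v, preferably one outside S.  It meets the vertex-vertices
-- only in S.
module EdgeTree {n : ℕ} (G : SimpleGraph n) (r : Fin n)
  (connected : ∀ x y → Walk (GraphFacts.A G) x y)
  (neighbour : ∀ v → Σ (Fin n) (GraphFacts.A G v))
  (S : GraphFacts.TV G → Set) (S? : ∀ t → Dec (S t)) where
  open GraphFacts G
  module R = Rooting G r connected

  rootEdge : E
  rootEdge = edgeOf r (proj₁ (neighbour r)) (proj₂ (neighbour r))

  rootEdge-inc : Inc r rootEdge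
  rootEdge-inc = edgeOf-inc₁ r (proj₁ (neighbour r)) (proj₂ (neighbour r))

  Free : Fin n → Fin n → Set
  Free v w = Σ (A v w) λ p → ¬ S (inj₂ (edgeOf v w p))

  Free? : ∀ v w → Dec (Free v w)
  Free? v w with adj G v w Bool.≟ true
  ... | no ¬p = no λ free → ¬p (proj₁ free)
  ... | yes p with S? (inj₂ (edgeOf v w p))
  ...   | no p∉S = yes (p , p∉S)
  ...   | yes p∈S = no λ (p′ , p′∉S) →
            p′∉S (subst (λ q → S (inj₂ (edgeOf v w q))) (A-irrelevant p p′) p∈S)

  choose : Fin n → E
  choose v with Fin.any? (Free? v)
  ... | yes (w , p , _) = edgeOf v w p
  ... | no _ = edgeOf v (proj₁ (neighbour v)) (proj₂ (neighbour v))

  choose-inc : ∀ v → Inc v (choose v)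
  choose-inc v with Fin.any? (Free? v)
  ... | yes (w , p , _) = edgeOf-inc₁ v w p
  ... | no _ = edgeOf-inc₁ v (proj₁ (neighbour v)) (proj₂ (neighbour v))

  choose-∈S : ∀ v → S (inj₂ (choose v)) → ∀ w (p : A v w) → S (inj₂ (edgeOf v w p))
  choose-∈S v chosen∈S w p with Fin.any? (Free? v)
  ... | yes (_ , _ , chosen∉S) = ⊥-elim (chosen∉S chosen∈S)
  ... | no no-free with S? (inj₂ (edgeOf v w p))
  ...   | yes vw∈S = vw∈S
  ...   | no vw∉S = ⊥-elim (no-free (w , p , vw∉S))

  lowEnd : E → Fin n
  lowEnd f with R.height (end₁ f) ≤? R.height (end₂ f)
  ... | yes _ = end₁ f
  ... | no _ = end₂ f

  lowEnd-inc : ∀ f → Inc (lowEnd f) f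
  lowEnd-inc f with R.height (end₁ f) ≤? R.height (end₂ f)
  ... | yes _ = inj₁ refl
  ... | no _ = inj₂ refl

  lowEnd-lowest : ∀ f w → Inc w f → R.height (lowEnd f) ≤ R.height w
  lowEnd-lowest f w w∈f with R.height (end₁ f) ≤? R.height (end₂ f)
  lowEnd-lowest f _ (inj₁ refl) | yes _ = ℕ.≤-refl
  lowEnd-lowest f _ (inj₂ refl) | yes h₁≤h₂ = h₁≤h₂
  lowEnd-lowest f _ (inj₁ refl) | no h₁≰h₂ = ℕ.<⇒≤ (ℕ.≰⇒> h₁≰h₂)
  lowEnd-lowest f _ (inj₂ refl) | no _ = ℕ.≤-refl

  edgeLevel : E → ℕ
  edgeLevel f with f ≟E rootEdge
  ... | yes _ = 0
  ... | no _ = suc (R.height (lowEnd f))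

  edgeLevel-root : edgeLevel rootEdge ≡ 0
  edgeLevel-root with rootEdge ≟E rootEdge
  ... | yes _ = refl
  ... | no ≢refl = ⊥-elim (≢refl refl)

  edgeLevel-nonRoot : ∀ f → f ≢ rootEdge → edgeLevel f ≡ suc (R.height (lowEnd f))
  edgeLevel-nonRoot f f≢root with f ≟E rootEdge
  ... | yes f≡root = ⊥-elim (f≢root f≡root)
  ... | no _ = refl

  edgeLevel-≤ : ∀ f → edgeLevel f ≤ suc (R.height (lowEnd f))
  edgeLevel-≤ f with f ≟E rootEdge
  ... | yes _ = z≤n
  ... | no _ = ℕ.≤-refl

  rootEdge-lowest : ∀ f → f ≢ rootEdge → edgeLevel rootEdge < edgeLevel f
  rootEdge-lowest f f≢root rewrite edgeLevel-root | edgeLevel-nonRoot f f≢root = s≤s z≤n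

  parentEdge : E → E
  parentEdge f with lowEnd f Fin.≟ r
  ... | yes _ = rootEdge
  ... | no z≢r = edgeOf (lowEnd f) (R.parent (lowEnd f)) (proj₁ (R.parent-spec (lowEnd f) z≢r))

  parentEdge-spec : ∀ f → f ≢ rootEdge →
                    EdgesAdjacent {G = G} f (parentEdge f) × edgeLevel (parentEdge f) < edgeLevel f
  parentEdge-spec f f≢root with lowEnd f Fin.≟ r | lowEnd-inc f | lowEnd-lowest f
  ... | yes z≡r | z∈f | _ =
    shared-end-adjacent f rootEdge f≢root z∈f (subst (λ u → Inc u rootEdge) (sym z≡r) rootEdge-inc) ,
    rootEdge-lowest f f≢root
  ... | no z≢r | z∈f | z-lowest =
    shared-end-adjacent f g f≢g z∈f (edgeOf-inc₁ z p z~p) , level-drops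
    where
    z p : Fin n
    z = lowEnd f
    p = R.parent z
    z~p : A z p
    z~p = proj₁ (R.parent-spec z z≢r)
    p<z : R.height p < R.height z
    p<z = proj₂ (R.parent-spec z z≢r)
    g : E
    g = edgeOf z p z~p
    f≢g : f ≢ g
    f≢g f≡g = ℕ.<⇒≱ p<z (z-lowest p (subst (Inc p) (sym f≡g) (edgeOf-inc₂ z p z~p)))
    level-drops : edgeLevel g < edgeLevel f
    level-drops = begin-strict
      edgeLevel g                 ≤⟨ edgeLevel-≤ g ⟩
      suc (R.height (lowEnd g))   ≤⟨ s≤s (lowEnd-lowest g p (edgeOf-inc₂ z p z~p)) ⟩
      suc (R.height p)            <⟨ s≤s p<z ⟩
      suc (R.height z)            ≡⟨ sym (edgeLevel-nonRoot f f≢root) ⟩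
      edgeLevel f                 ∎
      where open ℕ.≤-Reasoning

  InT NonRoot : TV → Set
  InT (inj₁ v) = S (inj₁ v)
  InT (inj₂ f) = ⊤
  NonRoot (inj₁ v) = S (inj₁ v)
  NonRoot (inj₂ f) = f ≢ rootEdge

  up : TV → TV
  up (inj₁ v) = inj₂ (choose v)
  up (inj₂ f) = inj₂ (parentEdge f)

  level : TV → ℕ
  level (inj₁ v) = suc (edgeLevel (choose v))
  level (inj₂ f) = edgeLevel f

  root-or-not : ∀ x → InT x → x ≡ inj₂ rootEdge ⊎ NonRoot x
  root-or-not (inj₁ v) v∈S = inj₂ v∈S
  root-or-not (inj₂ f) _ with f ≟E rootEdge
  ... | yes refl = inj₁ refl
  ... | no f≢root = inj₂ f≢root

  nonRoot∈T : ∀ {x} → NonRoot x → InT x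
  nonRoot∈T {inj₁ _} v∈S = v∈S
  nonRoot∈T {inj₂ _} _ = tt

  up∈T : ∀ {x} → NonRoot x → InT (up x)
  up∈T {inj₁ _} _ = tt
  up∈T {inj₂ _} _ = tt

  up-adj : ∀ {x} → NonRoot x → H x (up x)
  up-adj {inj₁ v} _ = choose-inc v
  up-adj {inj₂ f} f≢root = proj₁ (parentEdge-spec f f≢root)

  up-lower : ∀ {x} → NonRoot x → level (up x) < level x
  up-lower {inj₁ v} _ = ℕ.n<1+n _
  up-lower {inj₂ f} f≢root = proj₂ (parentEdge-spec f f≢root)

  open ParentTree H H-sym InT (inj₂ rootEdge) tt NonRoot root-or-not
    (λ {x} → nonRoot∈T {x}) up level (λ {x} → up∈T {x}) (λ {x} → up-adj {x})
    (λ {x} → up-lower {x}) public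

  S⊆T : ∀ t → S t → InT t
  S⊆T (inj₁ _) v∈S = v∈S
  S⊆T (inj₂ _) _ = tt

  isSTree : IsSTree S tree
  isSTree = S⊆T , isTree

oneSTree : {V : Set} {H : Graph V} {S : V → Set} (T : Subgraph H) → IsSTree S T →
           HasDisjointSTrees H S 1
oneSTree T T-ok = (λ _ → T) , (λ _ → T-ok) , λ { Fin.zero Fin.zero 0≢0 → ⊥-elim (0≢0 refl) }

twoSTrees : {V : Set} {H : Graph V} {S : V → Set} (T₀ T₁ : Subgraph H) →
            IsSTree S T₀ → IsSTree S T₁ → InternallyDisjoint S T₀ T₁ →
            HasDisjointSTrees H S 2
twoSTrees {S = S} T₀ T₁ T₀-ok T₁-ok (edges-disjoint , vertices-disjoint) = T , T-ok , T-disjoint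
  where
  T : Fin 2 → Subgraph _
  T Fin.zero = T₀
  T (Fin.suc Fin.zero) = T₁
  T-ok : ∀ i → IsSTree S (T i)
  T-ok Fin.zero = T₀-ok
  T-ok (Fin.suc Fin.zero) = T₁-ok
  T-disjoint : ∀ i j → i ≢ j → InternallyDisjoint S (T i) (T j)
  T-disjoint Fin.zero Fin.zero 0≢0 = ⊥-elim (0≢0 refl)
  T-disjoint Fin.zero (Fin.suc Fin.zero) _ = edges-disjoint , vertices-disjoint
  T-disjoint (Fin.suc Fin.zero) Fin.zero _ =
    (λ x y e₁ e₀ → edges-disjoint x y e₀ e₁) , (λ v v₁ v₀ → vertices-disjoint v v₀ v₁)
  T-disjoint (Fin.suc Fin.zero) (Fin.suc Fin.zero) 1≢1 = ⊥-elim (1≢1 refl)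

-- The
-- vertex tree and the edge tree can share only a link between an edge e ∈ S
-- and an end v ∈ S of it, namely when attach e = v and choose v = e; attach
-- is chosen to avoid this, which is possible unless S = {x, y, xy} with
-- x, y having no other neighbours -- impossible when G has a third vertex.
module LowerBound {n : ℕ} (G : SimpleGraph n) (r : Fin n)
  (connected : ∀ x y → Walk (GraphFacts.A G) x y)
  (third : ∀ (x y : Fin n) → Σ (Fin n) λ z → z ≢ x × z ≢ y)
  (s₁ s₂ s₃ : GraphFacts.TV G) (distinct : Distinct3 s₁ s₂ s₃) where
  open GraphFacts G

  S : TV → Set
  S = Three s₁ s₂ s₃

  S? : ∀ t → Dec (S t)
  S? t = (t ≟T s₁) ⊎-dec ((t ≟T s₂) ⊎-dec (t ≟T s₃))

  neighbour : ∀ v → Σ (Fin n) (A v)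
  neighbour v = firstStep (connected v z) (λ v≡z → z≢v (sym v≡z))
    where
    z : Fin n
    z = proj₁ (third v v)
    z≢v : z ≢ v
    z≢v = proj₁ (proj₂ (third v v))

  module ET = EdgeTree G r connected neighbour S S?
  open ET using (choose; choose-∈S)

  -- If S = {x, y, e} for an edge e = xy and both ends choose e, then every
  -- edge at x or y is e, so no walk leaves {x, y}; but a third vertex is
  -- reachable.
  chosen-by-both-ends : ∀ e → S (inj₂ e) → S (inj₁ (end₁ e)) → S (inj₁ (end₂ e)) →
                        choose (end₁ e) ≡ e → choose (end₂ e) ≡ e → ⊥
  chosen-by-both-ends e e∈S x∈S y∈S x-chooses-e y-chooses-e =
    z∉xy (stays-in-xy (connected x z) (inj₁ refl))
    where
    x y : Fin n
    x = end₁ e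
    y = end₂ e
    only-e : ∀ f → S (inj₂ f) → f ≡ e
    only-e f f∈S with Three-exhausted ((λ x≡y → ends-distinct e (inj₁-injective x≡y)) , (λ ()) , (λ ()))
                        x∈S y∈S e∈S f∈S
    ... | inj₂ (inj₂ f≡e) = inj₂-injective f≡e
    near-end : ∀ {u w} → choose u ≡ e → A u w → Inc w e
    near-end {u} {w} u-chooses-e u~w =
      subst (Inc w) (only-e _ (choose-∈S u (subst (λ f → S (inj₂ f)) (sym u-chooses-e) e∈S) w u~w))
        (edgeOf-inc₂ u w u~w)
    stays-in-xy : ∀ {u v} → Walk A u v → Inc u e → Inc v e
    stays-in-xy here u∈e = u∈e
    stays-in-xy (step u~w p) (inj₁ refl) = stays-in-xy p (near-end x-chooses-e u~w)
    stays-in-xy (step u~w p) (inj₂ refl) = stays-in-xy p (near-end y-chooses-e u~w)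
    z : Fin n
    z = proj₁ (third x y)
    z∉xy : ¬ Inc z e
    z∉xy (inj₁ z≡x) = proj₁ (proj₂ (third x y)) z≡x
    z∉xy (inj₂ z≡y) = proj₂ (proj₂ (third x y)) z≡y

  attach : E → Fin n
  attach e with S? (inj₁ (end₁ e)) ×-dec (choose (end₁ e) ≟E e)
  ... | yes _ = end₂ e
  ... | no _ = end₁ e

  attach-inc : ∀ e → Inc (attach e) e
  attach-inc e with S? (inj₁ (end₁ e)) ×-dec (choose (end₁ e) ≟E e)
  ... | yes _ = inj₂ refl
  ... | no _ = inj₁ refl

  attach-ok : ∀ e → S (inj₂ e) → S (inj₁ (attach e)) → choose (attach e) ≢ e
  attach-ok e e∈S a∈S a-chooses-e with S? (inj₁ (end₁ e)) ×-dec (choose (end₁ e) ≟E e)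
  ... | yes (x∈S , x-chooses-e) = chosen-by-both-ends e e∈S x∈S a∈S x-chooses-e a-chooses-e
  ... | no not-both = not-both (a∈S , a-chooses-e)

  module VT = VertexTree G r connected S attach attach-inc

  links-disjoint : ∀ x y → VT.Link x y → ET.Link x y → ⊥
  links-disjoint (inj₁ v) _ (inj₁ (_ , refl)) (inj₁ (_ , ()))
  links-disjoint (inj₂ e) _ (inj₁ (_ , refl)) (inj₁ (_ , ()))
  links-disjoint (inj₁ v) _ (inj₁ (_ , refl)) (inj₂ (_ , ()))
  links-disjoint (inj₂ e) _ (inj₁ (e∈S , refl)) (inj₂ (a∈S , e≡chosen)) =
    attach-ok e e∈S a∈S (sym (inj₂-injective e≡chosen))
  links-disjoint _ (inj₂ e) (inj₂ (e∈S , refl)) (inj₁ (a∈S , e≡chosen)) =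
    attach-ok e e∈S a∈S (sym (inj₂-injective e≡chosen))
  links-disjoint _ (inj₁ v) (inj₂ (_ , refl)) (inj₁ (_ , ()))
  links-disjoint _ (inj₁ v) (inj₂ (_ , refl)) (inj₂ (_ , ()))
  links-disjoint _ (inj₂ e) (inj₂ (_ , refl)) (inj₂ (_ , ()))

  vertices-disjoint : ∀ t → VT.InT t → ET.InT t → S t
  vertices-disjoint (inj₁ _) _ v∈S = v∈S
  vertices-disjoint (inj₂ _) e∈S _ = e∈S

  twoTrees : HasDisjointSTrees H S 2
  twoTrees = twoSTrees VT.tree ET.tree VT.isSTree ET.isSTree (links-disjoint , vertices-disjoint)

lookup-distinct : ∀ {V : Set} (xs : List V) → Unique xs → (i j : Fin (length xs)) → i <ᶠ j →
                  lookup xs i ≢ lookup xs j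
lookup-distinct (x ∷ xs) (x∉ ∷ _) Fin.zero (Fin.suc j) _ = all-lookup x∉ j
  where
  all-lookup : ∀ {P : _ → Set} {ys} → All P ys → ∀ k → P (lookup ys k)
  all-lookup (p ∷ _) Fin.zero = p
  all-lookup (_ ∷ ps) (Fin.suc k) = all-lookup ps k
lookup-distinct (x ∷ xs) (_ ∷ u) (Fin.suc i) (Fin.suc j) (s≤s i<j) = lookup-distinct xs u i j i<j

unique-length : ∀ {n} (xs : List (Fin n)) → Unique xs → length xs ≤ n
unique-length {n} xs u with length xs ≤? n
... | yes ok = ok
... | no too-long with Fin.pigeonhole (ℕ.≰⇒> too-long) (lookup xs)
...   | i , j , i<j , same = ⊥-elim (lookup-distinct xs u i j i<j same)

module Prefix {V : Set} {y : V} where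

  prefixTo : (z : V) (zs : List V) → y ∈ (z ∷ zs) → List V
  prefixTo z zs (here _) = []
  prefixTo z (z′ ∷ zs) (there y∈) = z′ ∷ prefixTo z′ zs y∈

  prefix-all : ∀ {P : V → Set} z zs y∈ → All P (z ∷ zs) → All P (z ∷ prefixTo z zs y∈)
  prefix-all z zs (here _) (p ∷ _) = p ∷ []
  prefix-all z (z′ ∷ zs) (there y∈) (p ∷ ps) = p ∷ prefix-all z′ zs y∈ ps

  prefix-unique : ∀ z zs y∈ → Unique (z ∷ zs) → Unique (z ∷ prefixTo z zs y∈)
  prefix-unique z zs (here _) _ = [] ∷ []
  prefix-unique z (z′ ∷ zs) (there y∈) (z∉ ∷ u) = prefix-all z′ zs y∈ z∉ ∷ prefix-unique z′ zs y∈ u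

  prefix-linked : ∀ {R : V → V → Set} {t} z zs y∈ → Linked R (z ∷ zs) → R y t →
                  Linked R ((z ∷ prefixTo z zs y∈) ∷ʳ t)
  prefix-linked z zs (here refl) _ y~t = y~t ∷ [-]
  prefix-linked z (z′ ∷ zs) (there y∈) (z~z′ ∷ l) y~t = z~z′ ∷ prefix-linked z′ zs y∈ l y~t

-- Every acyclic graph with an edge has a leaf: extend a path x′ x … at its
-- head x as long as x has a neighbour off the path.  This stops within n
-- steps, and then x is a leaf: a neighbour of x further along the path
-- would close a cycle.
module LeafSearch {n : ℕ} (G : SimpleGraph n) (acyclic : ¬ Cycle (GraphFacts.A G)) where
  open GraphFacts G
  open Prefix

  Leaf : Set
  Leaf = Σ (Fin n) λ x → Σ (Fin n) λ x′ → A x x′ × (∀ y → A x y → y ≡ x′)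

  no-chord : ∀ x x′ z zs y → Unique (x ∷ x′ ∷ z ∷ zs) → Linked A (x ∷ x′ ∷ z ∷ zs) →
             A x y → y ∈ (z ∷ zs) → ⊥
  no-chord x x′ z zs y ((x∉ₓ ∷ x∉) ∷ (x′∉ ∷ u)) (x~x′ ∷ x′~z ∷ l) x~y y∈ =
    acyclic (x , x′ , z , prefixTo z zs y∈ ,
             (x∉ₓ ∷ prefix-all z zs y∈ x∉) ∷ (prefix-all z zs y∈ x′∉ ∷ prefix-unique z zs y∈ u) ,
             x~x′ ∷ x′~z ∷ prefix-linked z zs y∈ l (A-sym x~y))

  head-is-leaf : ∀ x x′ rest → Unique (x ∷ x′ ∷ rest) → Linked A (x ∷ x′ ∷ rest) →
                 (∀ y → A x y → y ∈ (x ∷ x′ ∷ rest)) → ∀ y → A x y → y ≡ x′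
  head-is-leaf x x′ rest u l on-path y x~y with on-path y x~y
  ... | here y≡x = ⊥-elim (A-irrefl x~y (sym y≡x))
  ... | there (here y≡x′) = y≡x′
  head-is-leaf x x′ (z ∷ zs) u l on-path y x~y | there (there y∈) = ⊥-elim (no-chord x x′ z zs y u l x~y y∈)

  NewNeighbour : Fin n → List (Fin n) → Fin n → Set
  NewNeighbour x path y = A x y × ¬ (y ∈ path)

  NewNeighbour? : ∀ x path y → Dec (NewNeighbour x path y)
  NewNeighbour? x path y = (adj G x y Bool.≟ true) ×-dec ¬? (Any.any? (y Fin.≟_) path)

  -- fuel + length of the path exceeds n, so fuel runs out only on
  -- impossibly long paths
  extend : (fuel : ℕ) → ∀ x x′ rest → Unique (x ∷ x′ ∷ rest) → Linked A (x ∷ x′ ∷ rest) →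
           suc n ≤ length (x ∷ x′ ∷ rest) + fuel → Leaf
  extend zero x x′ rest u l long =
    ⊥-elim (ℕ.<⇒≱ (subst (suc n ≤_) (ℕ.+-identityʳ _) long) (unique-length _ u))
  extend (suc fuel) x x′ rest u l@(x~x′ ∷ _) long with Fin.any? (NewNeighbour? x (x ∷ x′ ∷ rest))
  ... | yes (y , x~y , y∉) =
    extend fuel y x (x′ ∷ rest) (off-path y∉ ∷ u) (A-sym x~y ∷ l) (subst (suc n ≤_) (ℕ.+-suc _ fuel) long)
    where
    off-path : ∀ {y zs} → ¬ (y ∈ zs) → All (y ≢_) zs
    off-path {zs = []} _ = []
    off-path {zs = z ∷ zs} y∉ = (λ y≡z → y∉ (here y≡z)) ∷ off-path (λ y∈ → y∉ (there y∈))
  ... | no none = x , x′ , x~x′ , head-is-leaf x x′ rest u l on-path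
    where
    on-path : ∀ y → A x y → y ∈ (x ∷ x′ ∷ rest)
    on-path y x~y with Any.any? (y Fin.≟_) (x ∷ x′ ∷ rest)
    ... | yes y∈ = y∈
    ... | no y∉ = ⊥-elim (none (y , x~y , y∉))

  leaf : ∀ x x′ → A x x′ → Leaf
  leaf x x′ x~x′ =
    extend (suc n) x′ x [] (((λ x′≡x → A-irrefl x~x′ (sym x′≡x)) ∷ []) ∷ [] ∷ []) (A-sym x~x′ ∷ [-])
      (ℕ.m≤n+m (suc n) 2)

module _ {V : Set} {H : Graph V} {S : V → Set} where

  edgeAt : ∀ (T : Subgraph H) {u v} → IsSTree S T → S u → S v → u ≢ v → Σ V (inE T u)
  edgeAt T (S⊆T , connected , _) u∈S v∈S u≢v = firstStep (connected _ _ (S⊆T _ u∈S) (S⊆T _ v∈S)) u≢v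

  edgeAmong : ∀ (T : Subgraph H) {a u} (d : ℕ) (nbr : Fin d → V) →
              (∀ t → H a t → Σ (Fin d) λ k → t ≡ nbr k) →
              IsSTree S T → S a → S u → a ≢ u → Σ (Fin d) λ k → inE T a (nbr k)
  edgeAmong T d nbr only-nbr T-ok a∈S u∈S a≢u with edgeAt T T-ok a∈S u∈S a≢u
  ... | t , a-t with only-nbr t (E-adj T a-t)
  ...   | k , refl = k , a-t

  -- If a ∈ S has only d neighbours nbr 0, …, nbr (d-1) and S has a second
  -- vertex, then κ(S) ≤ d: each of d+1 trees uses an edge at a, so two of
  -- them share one.
  degreeBound : ∀ {a u} (d : ℕ) (nbr : Fin d → V) → (∀ t → H a t → Σ (Fin d) λ k → t ≡ nbr k) →
                S a → S u → a ≢ u → ¬ HasDisjointSTrees H S (suc d)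
  degreeBound {a} d nbr only-nbr a∈S u∈S a≢u (T , T-ok , T-disjoint) =
    collision (Fin.pigeonhole (ℕ.n<1+n d) (λ i → proj₁ (used i)))
    where
    used : ∀ i → Σ (Fin d) λ k → inE (T i) a (nbr k)
    used i = edgeAmong (T i) d nbr only-nbr (T-ok i) a∈S u∈S a≢u
    collision : ¬ ∃₂ λ i j → i <ᶠ j × proj₁ (used i) ≡ proj₁ (used j)
    collision (i , j , i<j , same) =
      proj₁ (T-disjoint i j (Fin.<⇒≢ i<j)) a _ (proj₂ (used i))
        (subst (λ k → inE (T j) a (nbr k)) (sym same) (proj₂ (used j)))

-- κ({a, b, c}) ≤ 1 when a, b, c form a triangle with no other neighbours:
-- two disjoint trees would leave a along different edges, say ab and ac;
-- the first tree then needs an edge at c other than ca, i.e. cb, and the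
-- second an edge at b, which is one of ba, bc -- both already taken.
module _ {V : Set} {H : Graph V} {a b c : V} where

  private
    S : V → Set
    S = Three a b c

  edgeTo : ∀ (T : Subgraph H) {u v p q} → IsSTree S T → S u → S v → u ≢ v →
           (∀ t → H u t → t ≡ p ⊎ t ≡ q) → inE T u p ⊎ inE T u q
  edgeTo T T-ok u∈S v∈S u≢v only-pq with edgeAt T T-ok u∈S v∈S u≢v
  ... | t , u-t with only-pq t (E-adj T u-t)
  ...   | inj₁ refl = inj₁ u-t
  ...   | inj₂ refl = inj₂ u-t

  private
    a∈S : S a
    a∈S = inj₁ refl
    b∈S : S b
    b∈S = inj₂ (inj₁ refl)
    c∈S : S c
    c∈S = inj₂ (inj₂ refl)

  EdgeDisjoint : Subgraph H → Subgraph H → Set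
  EdgeDisjoint P Q = ∀ x y → inE P x y → inE Q x y → ⊥

  crossing : Distinct3 a b c → (∀ t → H b t → t ≡ a ⊎ t ≡ c) → (∀ t → H c t → t ≡ a ⊎ t ≡ b) →
             (P Q : Subgraph H) → IsSTree S P → IsSTree S Q → EdgeDisjoint P Q →
             inE P a b → inE Q a c → ⊥
  crossing (a≢b , a≢c , b≢c) nbr-b nbr-c P Q P-ok Q-ok disjoint P-ab Q-ac
    with edgeTo P P-ok c∈S a∈S (λ c≡a → a≢c (sym c≡a)) nbr-c
  ... | inj₁ P-ca = disjoint c a P-ca (E-sym Q Q-ac)
  ... | inj₂ P-cb with edgeTo Q Q-ok b∈S a∈S (λ b≡a → a≢b (sym b≡a)) nbr-b
  ...   | inj₁ Q-ba = disjoint b a (E-sym P P-ab) Q-ba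
  ...   | inj₂ Q-bc = disjoint b c (E-sym P P-cb) Q-bc

  triangleBound : Distinct3 a b c →
                  (∀ t → H a t → t ≡ b ⊎ t ≡ c) → (∀ t → H b t → t ≡ a ⊎ t ≡ c) →
                  (∀ t → H c t → t ≡ a ⊎ t ≡ b) → ¬ HasDisjointSTrees H S 2
  triangleBound distinct@(a≢b , _ , _) nbr-a nbr-b nbr-c (T , T-ok , T-disjoint) =
    leaving (edgeTo P P-ok a∈S b∈S a≢b nbr-a) (edgeTo Q Q-ok a∈S b∈S a≢b nbr-a)
    where
    P Q : Subgraph H
    P = T Fin.zero
    Q = T (Fin.suc Fin.zero)
    P-ok : IsSTree S P
    P-ok = T-ok Fin.zero
    Q-ok : IsSTree S Q
    Q-ok = T-ok (Fin.suc Fin.zero)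
    P|Q : EdgeDisjoint P Q
    P|Q = proj₁ (T-disjoint Fin.zero (Fin.suc Fin.zero) (λ ()))
    leaving : inE P a b ⊎ inE P a c → inE Q a b ⊎ inE Q a c → ⊥
    leaving (inj₁ P-ab) (inj₁ Q-ab) = P|Q a b P-ab Q-ab
    leaving (inj₂ P-ac) (inj₂ Q-ac) = P|Q a c P-ac Q-ac
    leaving (inj₁ P-ab) (inj₂ Q-ac) = crossing distinct nbr-b nbr-c P Q P-ok Q-ok P|Q P-ab Q-ac
    leaving (inj₂ P-ac) (inj₁ Q-ab) =
      crossing distinct nbr-b nbr-c Q P Q-ok P-ok (λ x y Q-xy P-xy → P|Q x y P-xy Q-xy) Q-ab P-ac

module PendantEdge {n : ℕ} (G : SimpleGraph n) (x x′ : Fin n) (x~x′ : GraphFacts.A G x x′)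
  (pendant : ∀ y → GraphFacts.A G x y → y ≡ x′) where
  open GraphFacts G

  e : E
  e = edgeOf x x′ x~x′

  a b c : TV
  a = inj₁ x
  b = inj₁ x′
  c = inj₂ e

  x≢x′ : x ≢ x′
  x≢x′ = A-irrefl x~x′

  distinct : Distinct3 a b c
  distinct = (λ a≡b → x≢x′ (inj₁-injective a≡b)) , (λ ()) , (λ ())

  is-e : ∀ f → Inc x f → Inc x′ f → f ≡ e
  is-e f x∈f x′∈f = edge-determined f e x≢x′ x∈f x′∈f (edgeOf-inc₁ x x′ x~x′) (edgeOf-inc₂ x x′ x~x′)

  nbr-a : ∀ t → H a t → t ≡ b ⊎ t ≡ c
  nbr-a (inj₁ y) x~y = inj₁ (cong inj₁ (pendant y x~y))
  nbr-a (inj₂ f) x∈f =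
    inj₂ (cong inj₂ (is-e f x∈f (subst (λ z → Inc z f) (pendant _ (otherEnd-adj f x∈f)) (otherEnd-inc f x∈f))))

  -- κ(S) ≤ 2: the vertex a has degree 2
  atMostTwo : ¬ HasDisjointSTrees H (Three a b c) 3
  atMostTwo = degreeBound 2 ends only-ends (inj₁ refl) (inj₂ (inj₁ refl)) (proj₁ distinct)
    where
    ends : Fin 2 → TV
    ends Fin.zero = b
    ends (Fin.suc Fin.zero) = c
    only-ends : ∀ t → H a t → Σ (Fin 2) λ k → t ≡ ends k
    only-ends t a~t with nbr-a t a~t
    ... | inj₁ t≡b = Fin.zero , t≡b
    ... | inj₂ t≡c = Fin.suc Fin.zero , t≡c

  -- κ(S) ≤ 1 when x, x′ are the only vertices: T(G) is the triangle a b c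
  atMostOne : (∀ y → y ≡ x ⊎ y ≡ x′) → ¬ HasDisjointSTrees H (Three a b c) 2
  atMostOne only-xx′ = triangleBound distinct nbr-a nbr-b nbr-c
    where
    only-e : ∀ f → f ≡ e
    only-e f with only-xx′ (end₁ f) | only-xx′ (end₂ f)
    ... | inj₁ p | inj₁ q = ⊥-elim (ends-distinct f (trans p (sym q)))
    ... | inj₂ p | inj₂ q = ⊥-elim (ends-distinct f (trans p (sym q)))
    ... | inj₁ p | inj₂ q = is-e f (inj₁ (sym p)) (inj₂ (sym q))
    ... | inj₂ p | inj₁ q = is-e f (inj₂ (sym q)) (inj₁ (sym p))
    nbr-b : ∀ t → H b t → t ≡ a ⊎ t ≡ c
    nbr-b (inj₁ y) x′~y with only-xx′ y
    ... | inj₁ y≡x = inj₁ (cong inj₁ y≡x)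
    ... | inj₂ y≡x′ = ⊥-elim (A-irrefl x′~y (sym y≡x′))
    nbr-b (inj₂ f) _ = inj₂ (cong inj₂ (only-e f))
    nbr-c : ∀ t → H c t → t ≡ a ⊎ t ≡ b
    nbr-c (inj₁ y) _ with only-xx′ y
    ... | inj₁ y≡x = inj₁ (cong inj₁ y≡x)
    ... | inj₂ y≡x′ = inj₂ (cong inj₁ y≡x′)
    nbr-c (inj₂ f) (e≢f , _) = ⊥-elim (e≢f (sym (only-e f)))

avoidTwo : ∀ {m} (x y : Fin (3 + m)) → Σ (Fin (3 + m)) λ z → z ≢ x × z ≢ y
avoidTwo x y with Fin.zero Fin.≟ x | Fin.zero Fin.≟ y
... | no 0≢x | no 0≢y = Fin.zero , 0≢x , 0≢y
... | yes refl | _ with Fin.suc Fin.zero Fin.≟ y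
...   | no 1≢y = Fin.suc Fin.zero , (λ ()) , 1≢y
...   | yes refl = Fin.suc (Fin.suc Fin.zero) , (λ ()) , (λ ())
avoidTwo x y | no _ | yes refl with Fin.suc Fin.zero Fin.≟ x
...   | no 1≢x = Fin.suc Fin.zero , 1≢x , (λ ())
...   | yes refl = Fin.suc (Fin.suc Fin.zero) , (λ ()) , (λ ())

onlyTwo : ∀ (x x′ : Fin 2) → x ≢ x′ → ∀ y → y ≡ x ⊎ y ≡ x′
onlyTwo Fin.zero Fin.zero 0≢0 _ = ⊥-elim (0≢0 refl)
onlyTwo (Fin.suc Fin.zero) (Fin.suc Fin.zero) 1≢1 _ = ⊥-elim (1≢1 refl)
onlyTwo Fin.zero (Fin.suc Fin.zero) _ Fin.zero = inj₁ refl
onlyTwo Fin.zero (Fin.suc Fin.zero) _ (Fin.suc Fin.zero) = inj₂ refl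
onlyTwo (Fin.suc Fin.zero) Fin.zero _ Fin.zero = inj₂ refl
onlyTwo (Fin.suc Fin.zero) Fin.zero _ (Fin.suc Fin.zero) = inj₁ refl

module TreeFacts {m : ℕ} (G : SimpleGraph (2 + m)) (tree : IsTree G) where
  open GraphFacts G

  connected : ∀ x y → Walk A x y
  connected x y = proj₁ tree x y tt tt

  pendantEdge : LeafSearch.Leaf G (proj₂ tree)
  pendantEdge with firstStep (connected Fin.zero (Fin.suc Fin.zero)) (λ ())
  ... | w , 0~w = LeafSearch.leaf G (proj₂ tree) Fin.zero w 0~w

  x x′ : Fin (2 + m)
  x = proj₁ pendantEdge
  x′ = proj₁ (proj₂ pendantEdge)

  module Pendant = PendantEdge G x x′ (proj₁ (proj₂ (proj₂ pendantEdge))) (proj₂ (proj₂ (proj₂ pendantEdge)))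

kappa3-K₂ : (G : SimpleGraph 2) → IsTree G → Kappa3Is (TotalGraph G) 1
kappa3-K₂ G tree =
  (λ s₁ s₂ s₃ _ → oneSTree (VT.tree s₁ s₂ s₃) (VT.isSTree s₁ s₂ s₃)) ,
  (a , b , c , distinct , atMostOne (onlyTwo x x′ x≢x′))
  where
  open TreeFacts G tree
  open Pendant
  module VT s₁ s₂ s₃ =
    VertexTree G Fin.zero connected (Three s₁ s₂ s₃) (GraphFacts.end₁ G) (λ _ → inj₁ refl)

kappa3-large : ∀ m (G : SimpleGraph (3 + m)) → IsTree G → Kappa3Is (TotalGraph G) 2
kappa3-large m G tree =
  (λ s₁ s₂ s₃ distinct → LowerBound.twoTrees G Fin.zero connected avoidTwo s₁ s₂ s₃ distinct) ,
  (a , b , c , distinct , atMostTwo)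
  where
  open TreeFacts G tree
  open Pendant

theorem3p1 : (n : ℕ) → 2 ≤ n → (G : SimpleGraph n) → IsTree G →
  (n ≡ 2 → Kappa3Is (TotalGraph G) 1) × (3 ≤ n → Kappa3Is (TotalGraph G) 2)
theorem3p1 (suc (suc m)) (s≤s (s≤s _)) G tree = edge-case m G tree , large-case m G tree
  where
  edge-case : ∀ m (G : SimpleGraph (2 + m)) → IsTree G → 2 + m ≡ 2 → Kappa3Is (TotalGraph G) 1
  edge-case zero G tree _ = kappa3-K₂ G tree
  large-case : ∀ m (G : SimpleGraph (2 + m)) → IsTree G → 3 ≤ 2 + m → Kappa3Is (TotalGraph G) 2
  large-case zero G tree (s≤s (s≤s ()))
  large-case (suc m) G tree _ = kappa3-large m G tree
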